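{- $$\sum_{n,m\ge 0}\binom{m}{2}b_2(m,n)q^n=\frac{q^6}{(q;q^2)_\infty(1-q^2)(1-q^4)}.$$
   Context: A partition of $n$ is a non-increasing finite sequence of positive integers summing to $n$ (the empty partition is the unique partition of $0$). Its Young diagram has $\lambda_i$ left-justified cells in row $i$; with $\lambda'_j$ the number of cells in column $j$, the hook length of cell $(i,j)$ is $h(i,j)=\lambda_i+\lambda'_j-i-j+1$. $b_2(m,n)$ is the number of partitions of $n$ into distinct parts whose Young diagram has exactly $m$ cells of hook length $2$. Notation: $(a;q)_\infty=\prod_{k\ge 0}(1-aq^k)$; the identity is one of formal power series in $q$. -}

module Defs where

open import Data.Nat using (ℕ; zero; suc; _+_; _*_; _∸_; _≤ᵇ_; _≡ᵇ_)
open import Data.Nat.Combinatorics using (_C_)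
open import Data.Bool using (Bool; true; false; if_then_else_)
open import Data.List using (List; []; _∷_; length; filterᵇ; map; concat; upTo; foldr)
open import Data.Nat.ListAction using (sum)
open import Data.Integer as ℤ using (ℤ)

subseqs : List ℕ → List (List ℕ)
subseqs []       = [] ∷ []
subseqs (x ∷ xs) = map (x ∷_) (subseqs xs) Data.List.++ subseqs xs

downFrom1 : ℕ → List ℕ
downFrom1 zero    = []
downFrom1 (suc n) = suc n ∷ downFrom1 n

-- All partitions of n into distinct parts, each listed once as a strictly
-- decreasing list of positive integers (a subset of {1..n} with sum n).
distinctPartitions : ℕ → List (List ℕ)
distinctPartitions n = filterᵇ (λ λs → sum λs ≡ᵇ n) (subseqs (downFrom1 n))

conj : List ℕ → ℕ → ℕ
conj λs j = length (filterᵇ (λ p → j ≤ᵇ p) λs)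

-- hook length of cell (i,j), 1-indexed: λ_i + λ'_j - i - j + 1
hook : List ℕ → ℕ → ℕ → ℕ → ℕ
hook λs λi i j = (λi + conj λs j + 1) ∸ (i + j)

hooks2From : List ℕ → ℕ → List ℕ → ℕ
hooks2From λs i []         = 0
hooks2From λs i (λi ∷ rest) =
  length (filterᵇ (λ j → hook λs λi i j ≡ᵇ 2) (map suc (upTo λi)))
  + hooks2From λs (suc i) rest

hooks2 : List ℕ → ℕ
hooks2 λs = hooks2From λs 1 λs

b₂ : ℕ → ℕ → ℕ
b₂ m n = length (filterᵇ (λ λs → hooks2 λs ≡ᵇ m) (distinctPartitions n))

Series : Set
Series = ℕ → ℤ

_⊛_ : Series → Series → Series
(f ⊛ g) n = foldr ℤ._+_ (ℤ.+ 0) (map (λ k → f k ℤ.* g (n ∸ k)) (upTo (suc n)))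

infixl 7 _⊛_

oneS : Series
oneS n = if n ≡ᵇ 0 then ℤ.+ 1 else ℤ.+ 0

qPow : ℕ → Series
qPow d n = if n ≡ᵇ d then ℤ.+ 1 else ℤ.+ 0

-- 1 - q^d  (d ≥ 1)
oneMinusQ : ℕ → Series
oneMinusQ d n = if n ≡ᵇ 0 then ℤ.+ 1 else (if n ≡ᵇ d then ℤ.- (ℤ.+ 1) else ℤ.+ 0)

prodUpTo : ℕ → (ℕ → Series) → Series
prodUpTo zero    F = oneS
prodUpTo (suc k) F = prodUpTo k F ⊛ F k

-- (q;q²)_∞ = ∏_{k≥0} (1 - q^{2k+1}); the coefficient of q^n only depends
-- on the factors with 2k+1 ≤ n, so it equals that of the finite product
-- over k < n+1.
qq2∞ : Series
qq2∞ n = prodUpTo (suc n) (λ k → oneMinusQ (2 * k + 1)) n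

-- Left-hand side: coefficient of q^n is Σ_{m ≥ 0} C(m,2) b₂(m,n);
-- b₂(m,n) = 0 for m > n (a diagram of size n has n cells), so m ≤ n suffices.
lhsSeries : Series
lhsSeries n = ℤ.+ sum (map (λ m → (m C 2) * b₂ m n) (upTo (suc n)))

{-# OPTIONS --safe #-}

-- Let distinctGF r N = Σ C(h₂(λ), r) q^|λ|, summed over the partitions λ into distinct parts ≤ N,
-- where h₂(λ) counts the cells of hook length 2; the left-hand side is the limit of distinctGF 2 N,
-- and distinctGF 0 N = (-q;q)_N. Splitting off the largest part M + 2 gives
--   distinctGF r (M + 2) = (1 + q^(M+2)) distinctGF r (M + 1) + q^(M+2) distinctGF (r - 1) M,
-- because the new first row has a cell of hook length 2 exactly when M + 1 is not a part, and then
-- Pascal's rule splits C(h₂ + 1, r). Induction on M turns this into the closed forms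
--   (1 - q²) distinctGF 1 (M + 2)         = q² (1 - q^(2M+2)) (-q;q)_M,
--   (1 - q²) (1 - q⁴) distinctGF 2 (M + 4) = q⁶ (1 - q^(2M+2)) (1 - q^(2M+4)) (-q;q)_M.
-- Modulo q^(n+1) the factors 1 - q^(2n+2) and 1 - q^(2n+4) are 1, and Euler's identity
-- (-q;q)_∞ (q;q²)_∞ = 1 follows from (-q;q)_N (q;q)_N = (q²;q²)_N and (q;q)_2K = (q;q²)_K (q²;q²)_K
-- by cancelling (q²;q²)_K. All identities are proved in the ring of integer power series modulo
-- q^(n+1).

module Submission where

open import Defs
open import Relation.Binary.PropositionalEquality using (_≡_)

open import Algebra.Bundles using (AbelianGroup; CommutativeRing)
import Algebra.Properties.CommutativeSemigroup as CommutativeSemigroupProperties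
import Algebra.Properties.Group as GroupProperties
import Algebra.Solver.Ring
open import Algebra.Solver.Ring.AlmostCommutativeRing using (_-Raw-AlmostCommutative⟶_; fromCommutativeRing)
open import Algebra.Structures using (IsCommutativeRing)
open import Data.Bool.Base using (Bool; true; false; if_then_else_; T)
open import Data.Integer.Base as ℤ using (ℤ; +_; _+_; _*_; -_)
import Data.Integer.Properties as ℤ
open import Data.List.Base using (List; []; _∷_; _++_; _∷ʳ_; map; foldr; length; filterᵇ; upTo; applyUpTo)
open import Data.List.Properties
  using (map-cong; map-upTo; applyUpTo-∷ʳ; ++-assoc; length-map; length-upTo;
         filter-accept; filter-reject; filter-none; filter-++; length-filter)
open import Data.List.Relation.Unary.All as All using (All; []; _∷_)
open import Data.List.Relation.Unary.All.Properties using (++⁺; map⁺; applyUpTo⁺₁; all-filter)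
open import Data.Maybe.Base using (Maybe; just; nothing)
open import Data.Nat.Base as ℕ using (ℕ; zero; suc; _∸_; _≤_; _<_; _≤′_; z≤n; s≤s; z<s; s<s; _≡ᵇ_)
open import Data.Nat.Combinatorics using (_C_; nCk+nC[k+1]≡[n+1]C[k+1])
open import Data.Nat.Induction using (<-rec)
open import Data.Nat.ListAction using (sum)
import Data.Nat.Properties as ℕ
open import Data.Product.Base using (_,_)
open import Function.Base using (_∘_; id)
open import Level using (0ℓ)
open import Relation.Binary.PropositionalEquality
  using (refl; sym; trans; cong; cong₂; subst; _≗_; module ≡-Reasoning)
import Relation.Binary.Reasoning.Setoid as SetoidReasoning
open import Relation.Binary.Structures using (IsEquivalence)
open import Relation.Nullary.Decidable.Core using (yes; no; T?)
open import Relation.Nullary.Negation.Core using (¬_)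

module ℤ+ = CommutativeSemigroupProperties ℤ.+-commutativeSemigroup
module ℕ+ = CommutativeSemigroupProperties ℕ.+-commutativeSemigroup
open GroupProperties (AbelianGroup.group ℤ.+-0-abelianGroup) using (∙-cancelʳ)

∑< : ℕ → (ℕ → ℤ) → ℤ
∑< zero    f = + 0
∑< (suc n) f = f 0 + ∑< n (f ∘ suc)

infix 5 ∑<
syntax ∑< n (λ k → e) = ∑[ k < n ] e

foldr-+-map-applyUpTo : ∀ (h : ℕ → ℤ) (f : ℕ → ℕ) n →
                        foldr _+_ (+ 0) (map h (applyUpTo f n)) ≡ ∑[ k < n ] h (f k)
foldr-+-map-applyUpTo h f zero    = refl
foldr-+-map-applyUpTo h f (suc n) = cong (_+_ (h (f 0))) (foldr-+-map-applyUpTo h (f ∘ suc) n)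

∑-cong : ∀ n {f g : ℕ → ℤ} → (∀ k → k < n → f k ≡ g k) → ∑< n f ≡ ∑< n g
∑-cong zero    _   = refl
∑-cong (suc n) f≡g = cong₂ _+_ (f≡g 0 z<s) (∑-cong n (λ k k<n → f≡g (suc k) (s<s k<n)))

∑-zero : ∀ n {f : ℕ → ℤ} → (∀ k → f k ≡ + 0) → ∑< n f ≡ + 0
∑-zero zero    _   = refl
∑-zero (suc n) f≡0 = cong₂ _+_ (f≡0 0) (∑-zero n (f≡0 ∘ suc))

∑-distrib-+ : ∀ n (f g : ℕ → ℤ) → ∑[ k < n ] (f k + g k) ≡ ∑< n f + ∑< n g
∑-distrib-+ zero    f g = refl
∑-distrib-+ (suc n) f g =
  trans (cong (_+_ (f 0 + g 0)) (∑-distrib-+ n (f ∘ suc) (g ∘ suc))) (ℤ+.interchange (f 0) (g 0) _ _)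

*-distribˡ-∑ : ∀ n c (f : ℕ → ℤ) → c * ∑< n f ≡ ∑[ k < n ] c * f k
*-distribˡ-∑ zero    c f = ℤ.*-zeroʳ c
*-distribˡ-∑ (suc n) c f =
  trans (ℤ.*-distribˡ-+ c (f 0) _) (cong (_+_ (c * f 0)) (*-distribˡ-∑ n c (f ∘ suc)))

*-distribʳ-∑ : ∀ n c (f : ℕ → ℤ) → ∑< n f * c ≡ ∑[ k < n ] f k * c
*-distribʳ-∑ n c f = trans (ℤ.*-comm (∑< n f) c)
                           (trans (*-distribˡ-∑ n c f) (∑-cong n (λ k _ → ℤ.*-comm c (f k))))

∑-last : ∀ n (f : ℕ → ℤ) → ∑< (suc n) f ≡ ∑< n f + f n
∑-last zero    f = ℤ.+-comm (f 0) (+ 0)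
∑-last (suc n) f = trans (cong (_+_ (f 0)) (∑-last n (f ∘ suc))) (sym (ℤ.+-assoc (f 0) _ _))

∑-reverse : ∀ n (f : ℕ → ℤ) → ∑< (suc n) f ≡ ∑[ k < suc n ] f (n ∸ k)
∑-reverse zero    f = refl
∑-reverse (suc n) f = begin
  f 0 + ∑< (suc n) (f ∘ suc)
    ≡⟨ cong (_+_ (f 0)) (∑-reverse n (f ∘ suc)) ⟩
  f 0 + (∑[ k < suc n ] f (suc (n ∸ k)))
    ≡⟨ ℤ.+-comm (f 0) _ ⟩
  (∑[ k < suc n ] f (suc (n ∸ k))) + f 0
    ≡⟨ cong₂ _+_ (∑-cong (suc n) shift) (cong f (sym (ℕ.n∸n≡0 n))) ⟩
  (∑[ k < suc n ] f (suc n ∸ k)) + f (suc n ∸ suc n)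
    ≡⟨ sym (∑-last (suc n) (λ k → f (suc n ∸ k))) ⟩
  ∑[ k < suc (suc n) ] f (suc n ∸ k) ∎
  where
  open ≡-Reasoning
  shift : ∀ k → k < suc n → f (suc (n ∸ k)) ≡ f (suc n ∸ k)
  shift k k<1+n = cong f (sym (ℕ.+-∸-assoc 1 (ℕ.≤-pred k<1+n)))

∑-triangle : ∀ m (a : ℕ → ℕ → ℤ) →
             ∑[ i < suc m ] ∑< (suc (m ∸ i)) (a i) ≡ ∑[ k < suc m ] ∑[ i < suc k ] a i (k ∸ i)
∑-triangle zero    a = refl
∑-triangle (suc m) a = begin
  ∑< (suc (suc m)) (a 0) + (∑[ i < suc m ] ∑< (suc (m ∸ i)) (a (suc i)))
    ≡⟨ cong (_+_ (∑< (suc (suc m)) (a 0))) (∑-triangle m (a ∘ suc)) ⟩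
  ∑< (suc (suc m)) (a 0) + (∑[ k < suc m ] ∑[ i < suc k ] a (suc i) (k ∸ i))
    ≡⟨ cong (_+_ (∑< (suc (suc m)) (a 0))) (sym (ℤ.+-identityˡ _)) ⟩
  ∑< (suc (suc m)) (a 0) + (∑[ k < suc (suc m) ] ∑[ i < k ] a (suc i) (k ∸ suc i))
    ≡⟨ sym (∑-distrib-+ (suc (suc m)) (a 0) (λ k → ∑[ i < k ] a (suc i) (k ∸ suc i))) ⟩
  ∑[ k < suc (suc m) ] ∑[ i < suc k ] a i (k ∸ i) ∎
  where open ≡-Reasoning

-- Integer power series and the Cauchy product

infixl 6 _⊕_ _⊝_
infix  8 ⊖_

_⊕_ : Series → Series → Series
(f ⊕ g) m = f m + g m

⊖_ : Series → Series
(⊖ f) m = - f m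

_⊝_ : Series → Series → Series
f ⊝ g = f ⊕ ⊖ g

𝟘 : Series
𝟘 _ = + 0

constS : ℤ → Series
constS c m = if m ≡ᵇ 0 then c else + 0

⊛-coeff : ∀ f g m → (f ⊛ g) m ≡ ∑[ k < suc m ] f k * g (m ∸ k)
⊛-coeff f g m = foldr-+-map-applyUpTo (λ k → f k * g (m ∸ k)) id (suc m)

⊛-comm : ∀ f g → f ⊛ g ≗ g ⊛ f
⊛-comm f g m = begin
  (f ⊛ g) m                                  ≡⟨ ⊛-coeff f g m ⟩
  ∑[ k < suc m ] f k * g (m ∸ k)             ≡⟨ ∑-reverse m (λ k → f k * g (m ∸ k)) ⟩
  ∑[ k < suc m ] f (m ∸ k) * g (m ∸ (m ∸ k)) ≡⟨ ∑-cong (suc m) swap ⟩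
  ∑[ k < suc m ] g k * f (m ∸ k)             ≡⟨ sym (⊛-coeff g f m) ⟩
  (g ⊛ f) m                                  ∎
  where
  open ≡-Reasoning
  swap : ∀ k → k < suc m → f (m ∸ k) * g (m ∸ (m ∸ k)) ≡ g k * f (m ∸ k)
  swap k k≤m rewrite ℕ.m∸[m∸n]≡n (ℕ.≤-pred k≤m) = ℤ.*-comm (f (m ∸ k)) (g k)

⊛-assoc : ∀ f g h → (f ⊛ g) ⊛ h ≗ f ⊛ (g ⊛ h)
⊛-assoc f g h m = begin
  ((f ⊛ g) ⊛ h) m
    ≡⟨ ⊛-coeff (f ⊛ g) h m ⟩
  ∑[ k < suc m ] (f ⊛ g) k * h (m ∸ k)
    ≡⟨ ∑-cong (suc m) (λ k _ → cong (_* h (m ∸ k)) (⊛-coeff f g k)) ⟩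
  ∑[ k < suc m ] (∑[ i < suc k ] f i * g (k ∸ i)) * h (m ∸ k)
    ≡⟨ ∑-cong (suc m) (λ k k≤m → distribute k (ℕ.≤-pred k≤m)) ⟩
  ∑[ k < suc m ] ∑[ i < suc k ] f i * g (k ∸ i) * h (m ∸ i ∸ (k ∸ i))
    ≡⟨ sym (∑-triangle m (λ i j → f i * g j * h (m ∸ i ∸ j))) ⟩
  ∑[ i < suc m ] ∑[ j < suc (m ∸ i) ] f i * g j * h (m ∸ i ∸ j)
    ≡⟨ ∑-cong (suc m) (λ i _ → factor i) ⟩
  ∑[ i < suc m ] f i * (g ⊛ h) (m ∸ i)
    ≡⟨ sym (⊛-coeff f (g ⊛ h) m) ⟩
  (f ⊛ (g ⊛ h)) m ∎
  where
  open ≡-Reasoning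
  distribute : ∀ k → k ≤ m → (∑[ i < suc k ] f i * g (k ∸ i)) * h (m ∸ k)
                             ≡ ∑[ i < suc k ] f i * g (k ∸ i) * h (m ∸ i ∸ (k ∸ i))
  distribute k k≤m =
    trans (*-distribʳ-∑ (suc k) (h (m ∸ k)) (λ i → f i * g (k ∸ i)))
          (∑-cong (suc k) (λ i i≤k → cong (λ j → f i * g (k ∸ i) * h j) (sym (∸-∸ i≤k))))
    where
    ∸-∸ : ∀ {i} → i < suc k → m ∸ i ∸ (k ∸ i) ≡ m ∸ k
    ∸-∸ {i} i≤k = trans (ℕ.∸-+-assoc m i (k ∸ i)) (cong (m ∸_) (ℕ.m+[n∸m]≡n (ℕ.≤-pred i≤k)))
  factor : ∀ i → ∑[ j < suc (m ∸ i) ] f i * g j * h (m ∸ i ∸ j) ≡ f i * (g ⊛ h) (m ∸ i)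
  factor i = begin
    ∑[ j < suc (m ∸ i) ] f i * g j * h (m ∸ i ∸ j)
      ≡⟨ ∑-cong (suc (m ∸ i)) (λ j _ → ℤ.*-assoc (f i) (g j) (h (m ∸ i ∸ j))) ⟩
    ∑[ j < suc (m ∸ i) ] f i * (g j * h (m ∸ i ∸ j))
      ≡⟨ sym (*-distribˡ-∑ (suc (m ∸ i)) (f i) (λ j → g j * h (m ∸ i ∸ j))) ⟩
    f i * (∑[ j < suc (m ∸ i) ] g j * h (m ∸ i ∸ j))
      ≡⟨ cong (f i *_) (sym (⊛-coeff g h (m ∸ i))) ⟩
    f i * (g ⊛ h) (m ∸ i) ∎

⊛-distribˡ-⊕ : ∀ f g h → f ⊛ (g ⊕ h) ≗ f ⊛ g ⊕ f ⊛ h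
⊛-distribˡ-⊕ f g h m = begin
  (f ⊛ (g ⊕ h)) m
    ≡⟨ ⊛-coeff f (g ⊕ h) m ⟩
  ∑[ k < suc m ] f k * (g (m ∸ k) + h (m ∸ k))
    ≡⟨ ∑-cong (suc m) (λ k _ → ℤ.*-distribˡ-+ (f k) (g (m ∸ k)) (h (m ∸ k))) ⟩
  ∑[ k < suc m ] (f k * g (m ∸ k) + f k * h (m ∸ k))
    ≡⟨ ∑-distrib-+ (suc m) (λ k → f k * g (m ∸ k)) (λ k → f k * h (m ∸ k)) ⟩
  (∑[ k < suc m ] f k * g (m ∸ k)) + (∑[ k < suc m ] f k * h (m ∸ k))
    ≡⟨ sym (cong₂ _+_ (⊛-coeff f g m) (⊛-coeff f h m)) ⟩
  (f ⊛ g ⊕ f ⊛ h) m ∎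
  where open ≡-Reasoning

constS-⊛ : ∀ c f m → (constS c ⊛ f) m ≡ c * f m
constS-⊛ c f m = begin
  (constS c ⊛ f) m
    ≡⟨ ⊛-coeff (constS c) f m ⟩
  c * f m + (∑[ k < m ] + 0 * f (m ∸ suc k))
    ≡⟨ cong (_+_ (c * f m)) (∑-zero m (λ k → ℤ.*-zeroˡ (f (m ∸ suc k)))) ⟩
  c * f m + + 0
    ≡⟨ ℤ.+-identityʳ (c * f m) ⟩
  c * f m ∎
  where open ≡-Reasoning

⊛-identityˡ : ∀ f → oneS ⊛ f ≗ f
⊛-identityˡ f m = trans (constS-⊛ (+ 1) f m) (ℤ.*-identityˡ (f m))

-- Power series modulo q^(n+1)

infix 4 _≈[_]_

-- A record rather than a Π-type, so that unification sees f and g instead of unfolding the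
-- Cauchy products inside them.
record _≈[_]_ (f : Series) (n : ℕ) (g : Series) : Set where
  constructor mk≈
  field coeff-≡ : ∀ m → m ≤ n → f m ≡ g m
open _≈[_]_ public

≗⇒≈ : ∀ {n f g} → f ≗ g → f ≈[ n ] g
≗⇒≈ f≗g = mk≈ (λ m _ → f≗g m)

≈-weaken : ∀ {m n f g} → m ≤ n → f ≈[ n ] g → f ≈[ m ] g
≈-weaken m≤n f≈g = mk≈ (λ k k≤m → coeff-≡ f≈g k (ℕ.≤-trans k≤m m≤n))

⊛-cong : ∀ {n f f′ g g′} → f ≈[ n ] f′ → g ≈[ n ] g′ → f ⊛ g ≈[ n ] f′ ⊛ g′
⊛-cong {n} {f} {f′} {g} {g′} f≈f′ g≈g′ = mk≈ coeff
  where
  open ≡-Reasoning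
  coeff : ∀ m → m ≤ n → (f ⊛ g) m ≡ (f′ ⊛ g′) m
  coeff m m≤n = begin
    (f ⊛ g) m
      ≡⟨ ⊛-coeff f g m ⟩
    ∑[ k < suc m ] f k * g (m ∸ k)
      ≡⟨ ∑-cong (suc m) (λ k k≤m → cong₂ _*_ (f≈f′-at k≤m) (g≈g′-at k)) ⟩
    ∑[ k < suc m ] f′ k * g′ (m ∸ k)
      ≡⟨ sym (⊛-coeff f′ g′ m) ⟩
    (f′ ⊛ g′) m ∎
    where
    f≈f′-at : ∀ {k} → k < suc m → f k ≡ f′ k
    f≈f′-at {k} k≤m = coeff-≡ f≈f′ k (ℕ.≤-trans (ℕ.≤-pred k≤m) m≤n)
    g≈g′-at : ∀ k → g (m ∸ k) ≡ g′ (m ∸ k)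
    g≈g′-at k = coeff-≡ g≈g′ (m ∸ k) (ℕ.≤-trans (ℕ.m∸n≤m m k) m≤n)

⊛-congˡ : ∀ {n} f {g g′} → g ≈[ n ] g′ → f ⊛ g ≈[ n ] f ⊛ g′
⊛-congˡ f = ⊛-cong {f = f} {f′ = f} (mk≈ (λ _ _ → refl))

⊛-congʳ : ∀ {n} g {f f′} → f ≈[ n ] f′ → f ⊛ g ≈[ n ] f′ ⊛ g
⊛-congʳ g f≈f′ = ⊛-cong {g = g} {g′ = g} f≈f′ (mk≈ (λ _ _ → refl))

⊕-congˡ : ∀ {n} f {g g′} → g ≈[ n ] g′ → f ⊕ g ≈[ n ] f ⊕ g′
⊕-congˡ f g≈g′ = mk≈ (λ m m≤n → cong (_+_ (f m)) (coeff-≡ g≈g′ m m≤n))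

⊕-congʳ : ∀ {n} g {f f′} → f ≈[ n ] f′ → f ⊕ g ≈[ n ] f′ ⊕ g
⊕-congʳ g f≈f′ = mk≈ (λ m m≤n → cong (_+ g m) (coeff-≡ f≈f′ m m≤n))

⊝-congˡ : ∀ {n} f {g g′} → g ≈[ n ] g′ → f ⊝ g ≈[ n ] f ⊝ g′
⊝-congˡ f g≈g′ = mk≈ (λ m m≤n → cong (λ c → f m + - c) (coeff-≡ g≈g′ m m≤n))

module _ (n : ℕ) where

  ≈-isEquivalence : IsEquivalence _≈[ n ]_
  ≈-isEquivalence = record
    { refl  = mk≈ (λ _ _ → refl)
    ; sym   = λ f≈g → mk≈ (λ m m≤n → sym (coeff-≡ f≈g m m≤n))
    ; trans = λ f≈g g≈h → mk≈ (λ m m≤n → trans (coeff-≡ f≈g m m≤n) (coeff-≡ g≈h m m≤n))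
    }

  ⊕-⊛-isCommutativeRing : IsCommutativeRing _≈[ n ]_ _⊕_ _⊛_ ⊖_ 𝟘 oneS
  ⊕-⊛-isCommutativeRing = record
    { isRing = record
      { +-isAbelianGroup = record
        { isGroup = record
          { isMonoid = record
            { isSemigroup = record
              { isMagma = record
                { isEquivalence = ≈-isEquivalence
                ; ∙-cong        = λ f≈f′ g≈g′ → mk≈ (λ m m≤n →
                                    cong₂ _+_ (coeff-≡ f≈f′ m m≤n) (coeff-≡ g≈g′ m m≤n))
                }
              ; assoc = λ f g h → ≗⇒≈ (λ m → ℤ.+-assoc (f m) (g m) (h m))
              }
            ; identity = (λ f → ≗⇒≈ (ℤ.+-identityˡ ∘ f)) , (λ f → ≗⇒≈ (ℤ.+-identityʳ ∘ f))
            }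
          ; inverse = (λ f → ≗⇒≈ (ℤ.+-inverseˡ ∘ f)) , (λ f → ≗⇒≈ (ℤ.+-inverseʳ ∘ f))
          ; ⁻¹-cong = λ f≈g → mk≈ (λ m m≤n → cong -_ (coeff-≡ f≈g m m≤n))
          }
        ; comm = λ f g → ≗⇒≈ (λ m → ℤ.+-comm (f m) (g m))
        }
      ; *-cong     = ⊛-cong
      ; *-assoc    = λ f g h → ≗⇒≈ (⊛-assoc f g h)
      ; *-identity = (λ f → ≗⇒≈ (⊛-identityˡ f))
                   , (λ f → ≗⇒≈ (λ m → trans (⊛-comm f oneS m) (⊛-identityˡ f m)))
      ; distrib    = (λ f g h → ≗⇒≈ (⊛-distribˡ-⊕ f g h))
                   , (λ f g h → ≗⇒≈ (λ m → trans (⊛-comm (g ⊕ h) f m)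
                                               (trans (⊛-distribˡ-⊕ f g h m)
                                                      (cong₂ _+_ (⊛-comm f g m) (⊛-comm f h m)))))
      }
    ; *-comm = λ f g → ≗⇒≈ (⊛-comm f g)
    }

  ⊕-⊛-commutativeRing : CommutativeRing 0ℓ 0ℓ
  ⊕-⊛-commutativeRing = record { isCommutativeRing = ⊕-⊛-isCommutativeRing }

  constS-homomorphism : ℤ.+-*-rawRing -Raw-AlmostCommutative⟶ fromCommutativeRing ⊕-⊛-commutativeRing
  constS-homomorphism = record
    { ⟦_⟧    = constS
    ; +-homo = λ x y → ≗⇒≈ (λ { zero → refl ; (suc _) → refl })
    ; *-homo = λ x y → ≗⇒≈ (λ m → sym (trans (constS-⊛ x (constS y) m) (*-constS x y m)))
    ; -‿homo = λ x → ≗⇒≈ (λ { zero → refl ; (suc _) → refl })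
    ; 0-homo = ≗⇒≈ (λ { zero → refl ; (suc _) → refl })
    ; 1-homo = ≗⇒≈ (λ _ → refl)
    }
    where
    *-constS : ∀ x y m → x * constS y m ≡ constS (x * y) m
    *-constS x y zero    = refl
    *-constS x y (suc m) = ℤ.*-zeroʳ x

  constS-≟ : ∀ x y → Maybe (constS x ≈[ n ] constS y)
  constS-≟ x y with x ℤ.≟ y
  ... | yes refl = just (mk≈ (λ _ _ → refl))
  ... | no  _    = nothing

module ⊛-Solver (n : ℕ) =
  Algebra.Solver.Ring ℤ.+-*-rawRing (fromCommutativeRing (⊕-⊛-commutativeRing n))
                      (constS-homomorphism n) (constS-≟ n)

module _ {n : ℕ} where
  open CommutativeRing (⊕-⊛-commutativeRing n) public
    using () renaming (refl to ≈-refl; sym to ≈-sym; trans to ≈-trans; +-cong to ⊕-cong)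

-- Coefficient m of a ⊛ f is a 0 * f m plus terms involving only lower coefficients of f.
⊛-cancelˡ : ∀ {n} a {f g} → a 0 ≡ + 1 → a ⊛ f ≈[ n ] a ⊛ g → f ≈[ n ] g
⊛-cancelˡ {n} a {f} {g} a₀≡1 af≈ag = mk≈ (<-rec (λ m → m ≤ n → f m ≡ g m) agree)
  where
  open ≡-Reasoning
  a₀-unit : ∀ x → a 0 * x ≡ x
  a₀-unit x = trans (cong (_* x) a₀≡1) (ℤ.*-identityˡ x)
  higher : Series → ℕ → ℤ
  higher h m = ∑[ k < m ] a (suc k) * h (m ∸ suc k)
  higher-agree : ∀ m → (∀ {k} → k < m → f k ≡ g k) → higher f m ≡ higher g m
  higher-agree zero    _     = refl
  higher-agree (suc m) below = ∑-cong (suc m) (λ k _ → cong (a (suc k) *_) (below (s≤s (ℕ.m∸n≤m m k))))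
  agree : ∀ m → (∀ {k} → k < m → k ≤ n → f k ≡ g k) → m ≤ n → f m ≡ g m
  agree m below m≤n = ∙-cancelʳ (higher f m) (f m) (g m) (begin
    f m + higher f m          ≡⟨ cong (_+ higher f m) (sym (a₀-unit (f m))) ⟩
    a 0 * f m + higher f m    ≡⟨ sym (⊛-coeff a f m) ⟩
    (a ⊛ f) m                 ≡⟨ coeff-≡ af≈ag m m≤n ⟩
    (a ⊛ g) m                 ≡⟨ ⊛-coeff a g m ⟩
    a 0 * g m + higher g m    ≡⟨ cong₂ _+_ (a₀-unit (g m)) (sym (higher-agree m below′)) ⟩
    g m + higher f m          ∎)
    where
    below′ : ∀ {k} → k < m → f k ≡ g k
    below′ k<m = below k<m (ℕ.≤-trans (ℕ.<⇒≤ k<m) m≤n)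

prodUpTo-coeff₀ : ∀ K (F : ℕ → Series) → (∀ k → F k 0 ≡ + 1) → prodUpTo K F 0 ≡ + 1
prodUpTo-coeff₀ zero    F F₀≡1 = refl
prodUpTo-coeff₀ (suc K) F F₀≡1 =
  trans (ℤ.+-identityʳ _) (cong₂ _*_ (prodUpTo-coeff₀ K F F₀≡1) (F₀≡1 K))

≈-stable : ∀ {n} (F : ℕ → Series) {K} → (∀ k → K ≤ k → F (suc k) ≈[ n ] F k) →
           ∀ {K′} → K ≤ K′ → F K′ ≈[ n ] F K
≈-stable {n} F {K} step K≤K′ = go (ℕ.≤⇒≤′ K≤K′)
  where
  go : ∀ {K′} → K ≤′ K′ → F K′ ≈[ n ] F K
  go (ℕ.≤′-reflexive refl) = ≈-refl
  go (ℕ.≤′-step K≤′k)      = ≈-trans (step _ (ℕ.≤′⇒≤ K≤′k)) (go K≤′k)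

prodUpTo-stable : ∀ {n} (F : ℕ → Series) {K} → (∀ k → K ≤ k → F k ≈[ n ] oneS) →
                  ∀ {K′} → K ≤ K′ → prodUpTo K′ F ≈[ n ] prodUpTo K F
prodUpTo-stable F F≈1 = ≈-stable (λ k → prodUpTo k F) (λ k K≤k →
  ≈-trans (⊛-congˡ (prodUpTo k F) (F≈1 k K≤k))
          (≗⇒≈ (λ m → trans (⊛-comm (prodUpTo k F) oneS m) (⊛-identityˡ (prodUpTo k F) m))))

qPow-suc-⊛ : ∀ d f m → (qPow (suc d) ⊛ f) (suc m) ≡ (qPow d ⊛ f) m
qPow-suc-⊛ d f m = begin
  (qPow (suc d) ⊛ f) (suc m)                   ≡⟨ ⊛-coeff (qPow (suc d)) f (suc m) ⟩
  + 0 + (∑[ k < suc m ] qPow d k * f (m ∸ k))  ≡⟨ ℤ.+-identityˡ _ ⟩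
  ∑[ k < suc m ] qPow d k * f (m ∸ k)          ≡⟨ sym (⊛-coeff (qPow d) f m) ⟩
  (qPow d ⊛ f) m                               ∎
  where open ≡-Reasoning

qPow-+ : ∀ a b → qPow a ⊛ qPow b ≗ qPow (a ℕ.+ b)
qPow-+ zero    b m       = ⊛-identityˡ (qPow b) m
qPow-+ (suc a) b zero    = refl
qPow-+ (suc a) b (suc m) = trans (qPow-suc-⊛ a (qPow b) m) (qPow-+ a b m)

qPow-< : ∀ {d m} → m < d → qPow d m ≡ + 0
qPow-< {suc d} {zero}  _         = refl
qPow-< {suc d} {suc m} (s<s m<d) = qPow-< m<d

oneMinusQ≗1⊝qPow : ∀ d → oneMinusQ (suc d) ≗ oneS ⊝ qPow (suc d)
oneMinusQ≗1⊝qPow d zero = refl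
oneMinusQ≗1⊝qPow d (suc m) with m ≡ᵇ d
... | true  = refl
... | false = refl

constS-+0 : ∀ m → constS (+ 0) m ≡ + 0
constS-+0 zero    = refl
constS-+0 (suc m) = refl

q : Series
q = qPow 1

infixr 8 _^_

-- Unlike qPow (k + 1), q ^ (k + 1) unfolds to q ⊛ q ^ k, which is how the ring solver reads products
-- of q; so q ^ k can be passed to the solver as an atom without losing its relation to q ^ (k + 1).
_^_ : Series → ℕ → Series
f ^ zero  = oneS
f ^ suc k = f ⊛ f ^ k

module _ {n : ℕ} where
  open ⊛-Solver n using (Polynomial; solve; _:=_; con; _:*_; _:^_)

  𝟏 : ∀ {k} → Polynomial k
  𝟏 = con (+ 1)

  qPow≈q^ : ∀ k → qPow k ≈[ n ] q ^ k
  qPow≈q^ zero    = ≈-refl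
  qPow≈q^ (suc k) = ≈-trans (≗⇒≈ (λ m → sym (qPow-+ 1 k m))) (⊛-congˡ q (qPow≈q^ k))

  ^-+ : ∀ f a b → f ^ (a ℕ.+ b) ≈[ n ] f ^ a ⊛ f ^ b
  ^-+ f zero    b = ≗⇒≈ (λ m → sym (⊛-identityˡ (f ^ b) m))
  ^-+ f (suc a) b = ≈-trans (⊛-congˡ f (^-+ f a b)) (≗⇒≈ (λ m → sym (⊛-assoc f (f ^ a) (f ^ b) m)))

  qPow6≈q²q²q² : qPow 6 ≈[ n ] q ^ 2 ⊛ q ^ 2 ⊛ q ^ 2
  qPow6≈q²q²q² = ≈-trans (qPow≈q^ 6) (≈-trans (^-+ q 4 2) (⊛-congʳ (q ^ 2) (^-+ q 2 2)))

  q^suc-squared : ∀ M → q ^ suc (suc M) ⊛ q ^ suc (suc M) ≈[ n ] q ^ 2 ⊛ (q ^ suc M ⊛ q ^ suc M)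
  q^suc-squared M = solve 2 (λ q y → q :* y :* (q :* y) := q :^ 2 :* (y :* y)) ≈-refl q (q ^ suc M)

  oneMinusQ≈1⊝q^ : ∀ d → oneMinusQ (suc d) ≈[ n ] oneS ⊝ q ^ suc d
  oneMinusQ≈1⊝q^ d = ≈-trans (≗⇒≈ (oneMinusQ≗1⊝qPow d)) (⊝-congˡ oneS (qPow≈q^ (suc d)))

  q^≈0 : ∀ {d} → n < d → q ^ d ≈[ n ] constS (+ 0)
  q^≈0 {d} n<d = mk≈ (λ m m≤n →
    trans (sym (coeff-≡ (qPow≈q^ d) m m≤n)) (trans (qPow-< (ℕ.≤-<-trans m≤n n<d)) (sym (constS-+0 m))))

-- Hook lengths of partitions into distinct parts

distinctUpTo : ℕ → List (List ℕ)
distinctUpTo N = subseqs (downFrom1 N)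

distinctUpTo-≤ : ∀ N → All (All (_≤ N)) (distinctUpTo N)
distinctUpTo-≤ zero    = [] ∷ []
distinctUpTo-≤ (suc N) = ++⁺ (map⁺ (All.map (λ ≤N → ℕ.≤-refl ∷ weaken ≤N) (distinctUpTo-≤ N)))
                             (All.map weaken (distinctUpTo-≤ N))
  where
  weaken : ∀ {λs} → All (_≤ N) λs → All (_≤ suc N) λs
  weaken = All.map ℕ.m≤n⇒m≤1+n

filterᵇ-cong : ∀ {p q : ℕ → Bool} {xs} → All (λ x → p x ≡ q x) xs → filterᵇ p xs ≡ filterᵇ q xs
filterᵇ-cong {xs = []}                  []            = refl
filterᵇ-cong {p = p} {q} {xs = x ∷ xs} (px≡qx ∷ p≡q) rewrite px≡qx with q x
... | true  = cong (x ∷_) (filterᵇ-cong p≡q)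
... | false = filterᵇ-cong p≡q

length-filterᵇ-∷ : ∀ {A : Set} (p : A → Bool) x xs →
                   length (filterᵇ p (x ∷ xs)) ≡ (if p x then 1 else 0) ℕ.+ length (filterᵇ p xs)
length-filterᵇ-∷ p x xs with p x
... | true  = refl
... | false = refl

map-suc-upTo-≤ : ∀ l → All (_≤ l) (map suc (upTo l))
map-suc-upTo-≤ l rewrite map-upTo suc l = applyUpTo⁺₁ suc l id

conj-∷-≤ : ∀ {j x} S → j ≤ x → conj (x ∷ S) j ≡ suc (conj S j)
conj-∷-≤ {j} S j≤x = cong length (filter-accept (T? ∘ (j ℕ.≤ᵇ_)) (ℕ.≤⇒≤ᵇ j≤x))

conj-≡0 : ∀ {j} S → All (_< j) S → conj S j ≡ 0
conj-≡0 {j} S S<j = cong length (filter-none (T? ∘ (j ℕ.≤ᵇ_)) (All.map j≰ S<j))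
  where
  j≰ : ∀ {x} → x < j → ¬ T (j ℕ.≤ᵇ x)
  j≰ x<j j≤x = ℕ.<⇒≱ x<j (ℕ.≤ᵇ⇒≤ j _ j≤x)

rowHooks2 : List ℕ → ℕ → ℕ → ℕ
rowHooks2 λs λi i = length (filterᵇ (λ j → hook λs λi i j ≡ᵇ 2) (map suc (upTo λi)))

rowHooks2-∷ : ∀ {x l} S i → l ≤ x → rowHooks2 (x ∷ S) l (suc i) ≡ rowHooks2 S l i
rowHooks2-∷ {x} {l} S i l≤x =
  cong length (filterᵇ-cong (All.map (λ j≤l → cong (_≡ᵇ 2) (hook-∷ (ℕ.≤-trans j≤l l≤x)))
                                     (map-suc-upTo-≤ l)))
  where
  hook-∷ : ∀ {j} → j ≤ x → hook (x ∷ S) l (suc i) j ≡ hook S l i j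
  hook-∷ {j} j≤x = trans (cong (λ c → (l ℕ.+ c ℕ.+ 1) ∸ suc (i ℕ.+ j)) (conj-∷-≤ S j≤x))
                         (cong (λ a → (a ℕ.+ 1) ∸ suc (i ℕ.+ j)) (ℕ.+-suc l (conj S j)))

hooks2From-∷ : ∀ {x} S i R → All (_≤ x) R → hooks2From (x ∷ S) (suc i) R ≡ hooks2From S i R
hooks2From-∷ S i []      []           = refl
hooks2From-∷ S i (l ∷ R) (l≤x ∷ R≤x) =
  cong₂ ℕ._+_ (rowHooks2-∷ S i l≤x) (hooks2From-∷ S (suc i) R R≤x)

hooks2-∷ : ∀ {x} S → All (_≤ x) S → hooks2 (x ∷ S) ≡ rowHooks2 (x ∷ S) x 1 ℕ.+ hooks2 S
hooks2-∷ {x} S S≤x = cong (rowHooks2 (x ∷ S) x 1 ℕ.+_) (hooks2From-∷ S 1 S S≤x)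

hook-firstRow : ∀ {x j} S → j ≤ x → hook (x ∷ S) x 1 j ≡ (x ∸ j) ℕ.+ suc (conj S j)
hook-firstRow {x} {j} S j≤x = begin
  (x ℕ.+ conj (x ∷ S) j ℕ.+ 1) ∸ suc j
    ≡⟨ cong (λ c → (x ℕ.+ c ℕ.+ 1) ∸ suc j) (conj-∷-≤ S j≤x) ⟩
  (x ℕ.+ suc (conj S j) ℕ.+ 1) ∸ suc j
    ≡⟨ cong (_∸ suc j) (ℕ.+-comm _ 1) ⟩
  (x ℕ.+ suc (conj S j)) ∸ j
    ≡⟨ ℕ.+-∸-comm (suc (conj S j)) j≤x ⟩
  (x ∸ j) ℕ.+ suc (conj S j) ∎
  where open ≡-Reasoning

-- Columns 1, …, M have hook length at least 3, and column M + 2 has hook length 1.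
rowHooks2-first : ∀ M S → All (_≤ suc M) S →
                  rowHooks2 (suc (suc M) ∷ S) (suc (suc M)) 1 ≡ (if conj S (suc M) ≡ᵇ 0 then 1 else 0)
rowHooks2-first M S S≤1+M = begin
  length (filterᵇ p (map suc (upTo x)))
    ≡⟨ cong (length ∘ filterᵇ p) columns ⟩
  length (filterᵇ p (applyUpTo suc M ++ suc M ∷ x ∷ []))
    ≡⟨ cong length (filter-++ (T? ∘ p) (applyUpTo suc M) (suc M ∷ x ∷ [])) ⟩
  length (filterᵇ p (applyUpTo suc M) ++ filterᵇ p (suc M ∷ x ∷ []))
    ≡⟨ cong (λ ys → length (ys ++ filterᵇ p (suc M ∷ x ∷ [])))
            (filter-none (T? ∘ p) (applyUpTo⁺₁ suc M early)) ⟩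
  length (filterᵇ p (suc M ∷ x ∷ []))
    ≡⟨ length-filterᵇ-∷ p (suc M) (x ∷ []) ⟩
  (if p (suc M) then 1 else 0) ℕ.+ length (filterᵇ p (x ∷ []))
    ≡⟨ cong₂ (λ b c → (if b then 1 else 0) ℕ.+ c)
             penultimate (cong length (filter-reject (T? ∘ p) {x} {[]} last)) ⟩
  (if conj S (suc M) ≡ᵇ 0 then 1 else 0) ℕ.+ 0
    ≡⟨ ℕ.+-identityʳ _ ⟩
  (if conj S (suc M) ≡ᵇ 0 then 1 else 0) ∎
  where
  open ≡-Reasoning
  x = suc (suc M)
  p : ℕ → Bool
  p j = hook (x ∷ S) x 1 j ≡ᵇ 2
  columns : map suc (upTo x) ≡ applyUpTo suc M ++ suc M ∷ x ∷ []
  columns = begin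
    map suc (upTo x)                 ≡⟨ map-upTo suc x ⟩
    applyUpTo suc x                  ≡⟨ sym (applyUpTo-∷ʳ suc (suc M)) ⟩
    applyUpTo suc (suc M) ∷ʳ x       ≡⟨ cong (_∷ʳ x) (sym (applyUpTo-∷ʳ suc M)) ⟩
    (applyUpTo suc M ∷ʳ suc M) ∷ʳ x  ≡⟨ ++-assoc (applyUpTo suc M) (suc M ∷ []) (x ∷ []) ⟩
    applyUpTo suc M ++ suc M ∷ x ∷ [] ∎
  early : ∀ {i} → i < M → ¬ T (p (suc i))
  early {i} i<M p[1+i] = ℕ.>⇒≢ (subst (2 <_) (sym (hook-firstRow S 1+i≤x)) 2<hook) (ℕ.≡ᵇ⇒≡ _ 2 p[1+i])
    where
    1+i≤x : suc i ≤ x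
    1+i≤x = ℕ.≤-trans i<M (ℕ.≤-trans (ℕ.n≤1+n M) (ℕ.n≤1+n (suc M)))
    2<hook : 2 < (x ∸ suc i) ℕ.+ suc (conj S (suc i))
    2<hook = ℕ.+-mono-≤ (ℕ.m+n≤o⇒m≤o∸n 2 (s≤s (s≤s i<M))) (s≤s z≤n)
  penultimate : p (suc M) ≡ (conj S (suc M) ≡ᵇ 0)
  penultimate = cong (_≡ᵇ 2) (trans (hook-firstRow S (ℕ.n≤1+n (suc M)))
                                    (cong (ℕ._+ suc (conj S (suc M))) (ℕ.m+n∸n≡m 1 M)))
  last : ¬ T (p x)
  last = subst T (cong (_≡ᵇ 2) (trans (hook-firstRow S ℕ.≤-refl)
                                     (cong₂ (λ d c → d ℕ.+ suc c) (ℕ.n∸n≡0 x)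
                                                                   (conj-≡0 S (All.map s≤s S≤1+M)))))

hooks2-∷-consecutive : ∀ M S → All (_≤ M) S → hooks2 (suc (suc M) ∷ suc M ∷ S) ≡ hooks2 (suc M ∷ S)
hooks2-∷-consecutive M S S≤M = begin
  hooks2 (suc (suc M) ∷ suc M ∷ S)
    ≡⟨ hooks2-∷ (suc M ∷ S) (All.map ℕ.m≤n⇒m≤1+n S′≤1+M) ⟩
  rowHooks2 (suc (suc M) ∷ suc M ∷ S) (suc (suc M)) 1 ℕ.+ hooks2 (suc M ∷ S)
    ≡⟨ cong (ℕ._+ hooks2 (suc M ∷ S)) (rowHooks2-first M (suc M ∷ S) S′≤1+M) ⟩
  (if conj (suc M ∷ S) (suc M) ≡ᵇ 0 then 1 else 0) ℕ.+ hooks2 (suc M ∷ S)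
    ≡⟨ cong (λ c → (if c ≡ᵇ 0 then 1 else 0) ℕ.+ hooks2 (suc M ∷ S))
            (conj-∷-≤ {suc M} S ℕ.≤-refl) ⟩
  hooks2 (suc M ∷ S) ∎
  where
  open ≡-Reasoning
  S′≤1+M : All (_≤ suc M) (suc M ∷ S)
  S′≤1+M = ℕ.≤-refl ∷ All.map ℕ.m≤n⇒m≤1+n S≤M

hooks2-∷-gap : ∀ M S → All (_≤ M) S → hooks2 (suc (suc M) ∷ S) ≡ suc (hooks2 S)
hooks2-∷-gap M S S≤M = begin
  hooks2 (suc (suc M) ∷ S)
    ≡⟨ hooks2-∷ S (All.map (ℕ.m≤n⇒m≤1+n ∘ ℕ.m≤n⇒m≤1+n) S≤M) ⟩
  rowHooks2 (suc (suc M) ∷ S) (suc (suc M)) 1 ℕ.+ hooks2 S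
    ≡⟨ cong (ℕ._+ hooks2 S) (rowHooks2-first M S (All.map ℕ.m≤n⇒m≤1+n S≤M)) ⟩
  (if conj S (suc M) ≡ᵇ 0 then 1 else 0) ℕ.+ hooks2 S
    ≡⟨ cong (λ c → (if c ≡ᵇ 0 then 1 else 0) ℕ.+ hooks2 S) (conj-≡0 S (All.map s≤s S≤M)) ⟩
  suc (hooks2 S) ∎
  where open ≡-Reasoning

hooks2From-≤ : ∀ λs i R → hooks2From λs i R ≤ sum R
hooks2From-≤ λs i []      = z≤n
hooks2From-≤ λs i (l ∷ R) = ℕ.+-mono-≤ row≤l (hooks2From-≤ λs (suc i) R)
  where
  row≤l : rowHooks2 λs l i ≤ l
  row≤l = ℕ.≤-trans (length-filter _ (map suc (upTo l)))
                    (ℕ.≤-reflexive (trans (length-map suc (upTo l)) (length-upTo l)))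

hooks2-≤ : ∀ λs → hooks2 λs ≤ sum λs
hooks2-≤ λs = hooks2From-≤ λs 1 λs

weightedGF : (List ℕ → ℕ) → List (List ℕ) → Series
weightedGF w []       = 𝟘
weightedGF w (λs ∷ L) = constS (+ w λs) ⊛ qPow (sum λs) ⊕ weightedGF w L

weightedGF-++ : ∀ w L L′ → weightedGF w (L ++ L′) ≗ weightedGF w L ⊕ weightedGF w L′
weightedGF-++ w []       L′ m = sym (ℤ.+-identityˡ (weightedGF w L′ m))
weightedGF-++ w (λs ∷ L) L′ m =
  trans (cong (_+_ term) (weightedGF-++ w L L′ m)) (sym (ℤ.+-assoc term (weightedGF w L m) (weightedGF w L′ m)))
  where term = (constS (+ w λs) ⊛ qPow (sum λs)) m

weightedGF-cong : ∀ {w w′} L → All (λ λs → w λs ≡ w′ λs) L → weightedGF w L ≗ weightedGF w′ L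
weightedGF-cong []       []           m = refl
weightedGF-cong (λs ∷ L) (w≡w′ ∷ ws) m =
  cong₂ _+_ (cong (λ c → (constS (+ c) ⊛ qPow (sum λs)) m) w≡w′) (weightedGF-cong L ws m)

weightedGF-+ : ∀ w w′ L → weightedGF (λ λs → w λs ℕ.+ w′ λs) L ≗ weightedGF w L ⊕ weightedGF w′ L
weightedGF-+ w w′ []       m = refl
weightedGF-+ w w′ (λs ∷ L) m =
  trans (cong₂ _+_ head (weightedGF-+ w w′ L m))
        (ℤ+.interchange (term w) (term w′) (weightedGF w L m) (weightedGF w′ L m))
  where
  open ≡-Reasoning
  x = qPow (sum λs) m
  term : (List ℕ → ℕ) → ℤ
  term v = (constS (+ v λs) ⊛ qPow (sum λs)) m
  head : term (λ λs → w λs ℕ.+ w′ λs) ≡ term w + term w′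
  head = begin
    term (λ λs → w λs ℕ.+ w′ λs)  ≡⟨ constS-⊛ (+ (w λs ℕ.+ w′ λs)) (qPow (sum λs)) m ⟩
    + (w λs ℕ.+ w′ λs) * x        ≡⟨ cong (_* x) (ℤ.pos-+ (w λs) (w′ λs)) ⟩
    (+ w λs + + w′ λs) * x        ≡⟨ ℤ.*-distribʳ-+ x (+ w λs) (+ w′ λs) ⟩
    + w λs * x + + w′ λs * x      ≡⟨ sym (cong₂ _+_ (constS-⊛ (+ w λs) (qPow (sum λs)) m)
                                                    (constS-⊛ (+ w′ λs) (qPow (sum λs)) m)) ⟩
    term w + term w′              ∎

≡ᵇ-sym : ∀ a b → (a ≡ᵇ b) ≡ (b ≡ᵇ a)
≡ᵇ-sym zero    zero    = refl
≡ᵇ-sym zero    (suc b) = refl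
≡ᵇ-sym (suc a) zero    = refl
≡ᵇ-sym (suc a) (suc b) = ≡ᵇ-sym a b

+-*-qPow : ∀ w d m → + w * qPow d m ≡ + (if d ≡ᵇ m then w else 0)
+-*-qPow w d m rewrite ≡ᵇ-sym m d with d ≡ᵇ m
... | true  = ℤ.*-identityʳ (+ w)
... | false = ℤ.*-zeroʳ (+ w)

sum-map-filterᵇ-∷ : ∀ {A : Set} (w : A → ℕ) (p : A → Bool) x xs →
                    sum (map w (filterᵇ p (x ∷ xs))) ≡ (if p x then w x else 0) ℕ.+ sum (map w (filterᵇ p xs))
sum-map-filterᵇ-∷ w p x xs with p x
... | true  = refl
... | false = refl

weightedGF-coeff : ∀ w L m → weightedGF w L m ≡ + sum (map w (filterᵇ (λ λs → sum λs ≡ᵇ m) L))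
weightedGF-coeff w []       m = refl
weightedGF-coeff w (λs ∷ L) m = begin
  (constS (+ w λs) ⊛ qPow (sum λs)) m + weightedGF w L m
    ≡⟨ cong₂ _+_ (trans (constS-⊛ (+ w λs) (qPow (sum λs)) m) (+-*-qPow (w λs) (sum λs) m))
                 (weightedGF-coeff w L m) ⟩
  + (if sum λs ≡ᵇ m then w λs else 0) + + sum (map w (filterᵇ p L))
    ≡⟨ sym (ℤ.pos-+ (if sum λs ≡ᵇ m then w λs else 0) (sum (map w (filterᵇ p L)))) ⟩
  + ((if sum λs ≡ᵇ m then w λs else 0) ℕ.+ sum (map w (filterᵇ p L)))
    ≡⟨ cong +_ (sym (sum-map-filterᵇ-∷ w p λs L)) ⟩
  + sum (map w (filterᵇ p (λs ∷ L))) ∎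
  where
  open ≡-Reasoning
  p = λ λs → sum λs ≡ᵇ m

distinctGF : ℕ → ℕ → Series
distinctGF r N = weightedGF (λ λs → hooks2 λs C r) (distinctUpTo N)

distinctGF₀-0 : distinctGF 0 0 ≗ oneS
distinctGF₀-0 m = trans (ℤ.+-identityʳ _) (⊛-identityˡ oneS m)

distinctGF₁-2 : distinctGF 1 2 ≗ qPow 2
distinctGF₁-2 m = trans (weightedGF-coeff _ (distinctUpTo 2) m) (enumerate m)
  where
  enumerate : ∀ m → + sum (map (λ λs → hooks2 λs C 1) (filterᵇ (λ λs → sum λs ≡ᵇ m) (distinctUpTo 2)))
                    ≡ qPow 2 m
  enumerate 0                         = refl
  enumerate 1                         = refl
  enumerate 2                         = refl
  enumerate 3                         = refl
  enumerate (suc (suc (suc (suc m)))) = refl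

-- (4, 2) is the only partition into distinct parts ≤ 4 with two cells of hook length 2.
distinctGF₂-4 : distinctGF 2 4 ≗ qPow 6
distinctGF₂-4 m = trans (weightedGF-coeff _ (distinctUpTo 4) m) (enumerate m)
  where
  enumerate : ∀ m → + sum (map (λ λs → hooks2 λs C 2) (filterᵇ (λ λs → sum λs ≡ᵇ m) (distinctUpTo 4)))
                    ≡ qPow 6 m
  enumerate 0  = refl
  enumerate 1  = refl
  enumerate 2  = refl
  enumerate 3  = refl
  enumerate 4  = refl
  enumerate 5  = refl
  enumerate 6  = refl
  enumerate 7  = refl
  enumerate 8  = refl
  enumerate 9  = refl
  enumerate 10 = refl
  enumerate (suc (suc (suc (suc (suc (suc (suc (suc (suc (suc (suc m))))))))))) = refl

sum-map-+ : ∀ {A : Set} (f g : A → ℕ) xs →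
            sum (map (λ x → f x ℕ.+ g x) xs) ≡ sum (map f xs) ℕ.+ sum (map g xs)
sum-map-+ f g []       = refl
sum-map-+ f g (x ∷ xs) = trans (cong (f x ℕ.+ g x ℕ.+_) (sum-map-+ f g xs)) (ℕ+.interchange (f x) (g x) _ _)

sum-applyUpTo-≡0 : ∀ (f : ℕ → ℕ) N → (∀ k → f k ≡ 0) → sum (applyUpTo f N) ≡ 0
sum-applyUpTo-≡0 f zero    f≡0 = refl
sum-applyUpTo-≡0 f (suc N) f≡0 = cong₂ ℕ._+_ (f≡0 0) (sum-applyUpTo-≡0 (f ∘ suc) N (f≡0 ∘ suc))

sum-upTo-δ : ∀ N c (g : ℕ → ℕ) → c < N → sum (map (λ k → if c ≡ᵇ k then g k else 0) (upTo N)) ≡ g c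
sum-upTo-δ N c g c<N rewrite map-upTo (λ k → if c ≡ᵇ k then g k else 0) N = go N c g c<N
  where
  go : ∀ N c (g : ℕ → ℕ) → c < N → sum (applyUpTo (λ k → if c ≡ᵇ k then g k else 0) N) ≡ g c
  go (suc N) zero    g _         =
    trans (cong (g 0 ℕ.+_) (sum-applyUpTo-≡0 _ N (λ _ → refl))) (ℕ.+-identityʳ (g 0))
  go (suc N) (suc c) g (s<s c<N) = go N c (g ∘ suc) c<N

sum-weighted-counts : ∀ {A : Set} (g : ℕ → ℕ) (h : A → ℕ) m xs → All (λ a → h a ≤ m) xs →
                      sum (map (λ k → g k ℕ.* length (filterᵇ (λ a → h a ≡ᵇ k) xs)) (upTo (suc m)))
                      ≡ sum (map (g ∘ h) xs)
sum-weighted-counts g h m []       []         =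
  trans (cong sum (map-upTo _ (suc m))) (sum-applyUpTo-≡0 _ (suc m) (λ k → ℕ.*-zeroʳ (g k)))
sum-weighted-counts g h m (a ∷ xs) (ha≤m ∷ hs) = begin
  sum (map (λ k → g k ℕ.* count k (a ∷ xs)) (upTo (suc m)))
    ≡⟨ cong sum (map-cong split (upTo (suc m))) ⟩
  sum (map (λ k → δ k ℕ.+ g k ℕ.* count k xs) (upTo (suc m)))
    ≡⟨ sum-map-+ δ (λ k → g k ℕ.* count k xs) (upTo (suc m)) ⟩
  sum (map δ (upTo (suc m))) ℕ.+ sum (map (λ k → g k ℕ.* count k xs) (upTo (suc m)))
    ≡⟨ cong₂ ℕ._+_ (sum-upTo-δ (suc m) (h a) g (s≤s ha≤m)) (sum-weighted-counts g h m xs hs) ⟩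
  g (h a) ℕ.+ sum (map (g ∘ h) xs) ∎
  where
  open ≡-Reasoning
  count : ℕ → List _ → ℕ
  count k ys = length (filterᵇ (λ b → h b ≡ᵇ k) ys)
  δ : ℕ → ℕ
  δ k = if h a ≡ᵇ k then g k else 0
  split : ∀ k → g k ℕ.* count k (a ∷ xs) ≡ δ k ℕ.+ g k ℕ.* count k xs
  split k with h a ≡ᵇ k
  ... | true  = ℕ.*-suc (g k) (count k xs)
  ... | false = refl

lhsSeries≡distinctGF₂ : ∀ m → lhsSeries m ≡ distinctGF 2 m m
lhsSeries≡distinctGF₂ m = begin
  + sum (map (λ k → (k C 2) ℕ.* b₂ k m) (upTo (suc m)))
    ≡⟨ cong +_ (sum-weighted-counts (_C 2) hooks2 m (distinctPartitions m) hooks2≤m) ⟩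
  + sum (map (λ λs → hooks2 λs C 2) (distinctPartitions m))
    ≡⟨ sym (weightedGF-coeff (λ λs → hooks2 λs C 2) (distinctUpTo m) m) ⟩
  distinctGF 2 m m ∎
  where
  open ≡-Reasoning
  hooks2≤m : All (λ λs → hooks2 λs ≤ m) (distinctPartitions m)
  hooks2≤m = All.map (λ {λs} sum≡m → subst (hooks2 λs ≤_) (ℕ.≡ᵇ⇒≡ (sum λs) m sum≡m) (hooks2-≤ λs))
                     (all-filter (T? ∘ (λ λs → sum λs ≡ᵇ m)) (distinctUpTo m))

-- Recurrences and closed forms

module _ {n : ℕ} where
  open SetoidReasoning (CommutativeRing.setoid (⊕-⊛-commutativeRing n))
  open CommutativeRing (⊕-⊛-commutativeRing n) using (zeroʳ)
  open ⊛-Solver n using (solve; _:=_; _:+_; _:-_; _:*_)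

  weightedGF-map-∷ : ∀ w x L → weightedGF w (map (x ∷_) L) ≈[ n ] q ^ x ⊛ weightedGF (w ∘ (x ∷_)) L
  weightedGF-map-∷ w x []       = ≈-sym (zeroʳ (q ^ x))
  weightedGF-map-∷ w x (λs ∷ L) = begin
    c ⊛ qPow (x ℕ.+ sum λs) ⊕ weightedGF w (map (x ∷_) L)
      ≈⟨ ⊕-cong (⊛-congˡ c qPow-x+s) (weightedGF-map-∷ w x L) ⟩
    c ⊛ (q ^ x ⊛ qPow (sum λs)) ⊕ q ^ x ⊛ G
      ≈⟨ solve 4 (λ c y p g → c :* (y :* p) :+ y :* g := y :* (c :* p :+ g))
                 ≈-refl c (q ^ x) (qPow (sum λs)) G ⟩
    q ^ x ⊛ (c ⊛ qPow (sum λs) ⊕ G) ∎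
    where
    c = constS (+ w (x ∷ λs))
    G = weightedGF (w ∘ (x ∷_)) L
    qPow-x+s : qPow (x ℕ.+ sum λs) ≈[ n ] q ^ x ⊛ qPow (sum λs)
    qPow-x+s = ≈-trans (≗⇒≈ (λ m → sym (qPow-+ x (sum λs) m))) (⊛-congʳ (qPow (sum λs)) (qPow≈q^ x))

  distinctGF-suc : ∀ r N → distinctGF r (suc N)
                           ≈[ n ] q ^ suc N ⊛ weightedGF (λ λs → hooks2 (suc N ∷ λs) C r) (distinctUpTo N)
                                  ⊕ distinctGF r N
  distinctGF-suc r N = ≈-trans (≗⇒≈ (weightedGF-++ w (map (suc N ∷_) (distinctUpTo N)) (distinctUpTo N)))
                               (⊕-congʳ (distinctGF r N) (weightedGF-map-∷ w (suc N) (distinctUpTo N)))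
    where w = λ λs → hooks2 λs C r

  distinctGF₀-suc : ∀ N → distinctGF 0 (suc N) ≈[ n ] (oneS ⊕ q ^ suc N) ⊛ distinctGF 0 N
  distinctGF₀-suc N = begin
    distinctGF 0 (suc N)    ≈⟨ distinctGF-suc 0 N ⟩
    q ^ suc N ⊛ D ⊕ D       ≈⟨ solve 2 (λ y d → y :* d :+ d := (𝟏 :+ y) :* d) ≈-refl (q ^ suc N) D ⟩
    (oneS ⊕ q ^ suc N) ⊛ D  ∎
    where D = distinctGF 0 N

  -- A partition with largest part M + 2 either contains M + 1, and then the first row has no cell
  -- of hook length 2, or it does not, and then the first row has exactly one such cell.
  distinctGF-suc-suc : ∀ r M → distinctGF (suc r) (suc (suc M))
                               ≈[ n ] (oneS ⊕ q ^ suc (suc M)) ⊛ distinctGF (suc r) (suc M)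
                                      ⊕ q ^ suc (suc M) ⊛ distinctGF r M
  distinctGF-suc-suc r M = begin
    distinctGF (suc r) (suc (suc M))
      ≈⟨ distinctGF-suc (suc r) (suc M) ⟩
    x ⊛ weightedGF (w ∘ (suc (suc M) ∷_)) (map (suc M ∷_) L ++ L) ⊕ D′
      ≈⟨ ⊕-cong (⊛-congˡ x (≗⇒≈ split)) D′≈A⊕D ⟩
    x ⊛ (A ⊕ (Dᵣ ⊕ D)) ⊕ (A ⊕ D)
      ≈⟨ solve 4 (λ x A a d → x :* (A :+ (a :+ d)) :+ (A :+ d) := (𝟏 :+ x) :* (A :+ d) :+ x :* a)
                 ≈-refl x A Dᵣ D ⟩
    (oneS ⊕ x) ⊛ (A ⊕ D) ⊕ x ⊛ Dᵣ
      ≈⟨ ⊕-congʳ (x ⊛ Dᵣ) (⊛-congˡ (oneS ⊕ x) (≈-sym D′≈A⊕D)) ⟩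
    (oneS ⊕ x) ⊛ D′ ⊕ x ⊛ Dᵣ ∎
    where
    x = q ^ suc (suc M)
    w = λ λs → hooks2 λs C suc r
    L = distinctUpTo M
    A = weightedGF w (map (suc M ∷_) L)
    D = distinctGF (suc r) M
    D′ = distinctGF (suc r) (suc M)
    Dᵣ = distinctGF r M
    D′≈A⊕D : D′ ≈[ n ] A ⊕ D
    D′≈A⊕D = ≗⇒≈ (weightedGF-++ w (map (suc M ∷_) L) L)
    consecutive : All (λ λs → w (suc (suc M) ∷ λs) ≡ w λs) (map (suc M ∷_) L)
    consecutive = map⁺ (All.map (λ {λs} λs≤M → cong (_C suc r) (hooks2-∷-consecutive M λs λs≤M))
                                (distinctUpTo-≤ M))
    pascal : All (λ λs → w (suc (suc M) ∷ λs) ≡ hooks2 λs C r ℕ.+ w λs) L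
    pascal = All.map (λ {λs} λs≤M → trans (cong (_C suc r) (hooks2-∷-gap M λs λs≤M))
                                          (sym (nCk+nC[k+1]≡[n+1]C[k+1] (hooks2 λs) r)))
                     (distinctUpTo-≤ M)
    split : weightedGF (w ∘ (suc (suc M) ∷_)) (map (suc M ∷_) L ++ L) ≗ A ⊕ (Dᵣ ⊕ D)
    split m = trans (weightedGF-++ (w ∘ (suc (suc M) ∷_)) (map (suc M ∷_) L) L m)
                    (cong₂ _+_ (weightedGF-cong (map (suc M ∷_) L) consecutive m)
                               (trans (weightedGF-cong L pascal m) (weightedGF-+ (λ λs → hooks2 λs C r) w L m)))

  distinctGF₁-closed : ∀ M → (oneS ⊝ q ^ 2) ⊛ distinctGF 1 (suc (suc M))
                             ≈[ n ] q ^ 2 ⊛ (oneS ⊝ q ^ suc M ⊛ q ^ suc M) ⊛ distinctGF 0 M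
  distinctGF₁-closed zero = begin
    (oneS ⊝ Q) ⊛ distinctGF 1 2
      ≈⟨ ⊛-congˡ (oneS ⊝ Q) (≈-trans (≗⇒≈ distinctGF₁-2) (qPow≈q^ 2)) ⟩
    (oneS ⊝ Q) ⊛ Q
      ≈⟨ solve 1 (λ Q → (𝟏 :- Q) :* Q := Q :* (𝟏 :- Q) :* 𝟏) ≈-refl Q ⟩
    Q ⊛ (oneS ⊝ Q) ⊛ oneS
      ≈⟨ ⊛-cong (⊛-congˡ Q (⊝-congˡ oneS (^-+ q 1 1))) (≈-sym (≗⇒≈ distinctGF₀-0)) ⟩
    Q ⊛ (oneS ⊝ q ^ 1 ⊛ q ^ 1) ⊛ distinctGF 0 0 ∎
    where Q = q ^ 2
  distinctGF₁-closed (suc M) = begin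
    a ⊛ distinctGF 1 (3 ℕ.+ M)
      ≈⟨ ⊛-congˡ a (distinctGF-suc-suc 0 (suc M)) ⟩
    a ⊛ ((oneS ⊕ x) ⊛ D₁ ⊕ x ⊛ D₀′)
      ≈⟨ solve 4 (λ a x d₁ d₀′ → a :* ((𝟏 :+ x) :* d₁ :+ x :* d₀′)
                              := (𝟏 :+ x) :* (a :* d₁) :+ a :* x :* d₀′)
                 ≈-refl a x D₁ D₀′ ⟩
    (oneS ⊕ x) ⊛ (a ⊛ D₁) ⊕ a ⊛ x ⊛ D₀′
      ≈⟨ ⊕-cong (⊛-cong (⊕-congˡ oneS x≈Qy) (distinctGF₁-closed M))
                (⊛-cong (⊛-congˡ a x≈Qy) (distinctGF₀-suc M)) ⟩
    (oneS ⊕ Q ⊛ y) ⊛ (Q ⊛ (oneS ⊝ y ⊛ y) ⊛ D₀) ⊕ a ⊛ (Q ⊛ y) ⊛ ((oneS ⊕ y) ⊛ D₀)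
      ≈⟨ solve 3 (λ Q y d₀ → (𝟏 :+ Q :* y) :* (Q :* (𝟏 :- y :* y) :* d₀)
                               :+ (𝟏 :- Q) :* (Q :* y) :* ((𝟏 :+ y) :* d₀)
                          := Q :* (𝟏 :- Q :* (y :* y)) :* ((𝟏 :+ y) :* d₀))
                 ≈-refl Q y D₀ ⟩
    Q ⊛ (oneS ⊝ Q ⊛ (y ⊛ y)) ⊛ ((oneS ⊕ y) ⊛ D₀)
      ≈⟨ ⊛-cong (⊛-congˡ Q (⊝-congˡ oneS (≈-sym (q^suc-squared M)))) (≈-sym (distinctGF₀-suc M)) ⟩
    Q ⊛ (oneS ⊝ q ^ suc (suc M) ⊛ q ^ suc (suc M)) ⊛ D₀′ ∎
    where
    Q = q ^ 2
    a = oneS ⊝ Q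
    y = q ^ suc M
    x = q ^ (3 ℕ.+ M)
    D₀ = distinctGF 0 M
    D₀′ = distinctGF 0 (suc M)
    D₁ = distinctGF 1 (suc (suc M))
    x≈Qy : x ≈[ n ] Q ⊛ y
    x≈Qy = ^-+ q 2 (suc M)

  distinctGF₂-closed : ∀ M → (oneS ⊝ q ^ 2) ⊛ (oneS ⊝ q ^ 2 ⊛ q ^ 2) ⊛ distinctGF 2 (4 ℕ.+ M)
                             ≈[ n ] q ^ 2 ⊛ q ^ 2 ⊛ q ^ 2 ⊛ (oneS ⊝ q ^ suc M ⊛ q ^ suc M)
                                    ⊛ (oneS ⊝ q ^ 2 ⊛ (q ^ suc M ⊛ q ^ suc M)) ⊛ distinctGF 0 M
  distinctGF₂-closed zero = begin
    a ⊛ b ⊛ distinctGF 2 4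
      ≈⟨ ⊛-congˡ (a ⊛ b) (≈-trans (≗⇒≈ distinctGF₂-4) qPow6≈q²q²q²) ⟩
    a ⊛ b ⊛ (Q ⊛ Q ⊛ Q)
      ≈⟨ solve 1 (λ Q → (𝟏 :- Q) :* (𝟏 :- Q :* Q) :* (Q :* Q :* Q)
                     := Q :* Q :* Q :* (𝟏 :- Q) :* (𝟏 :- Q :* Q) :* 𝟏)
                 ≈-refl Q ⟩
    Q ⊛ Q ⊛ Q ⊛ a ⊛ b ⊛ oneS
      ≈⟨ ⊛-cong (⊛-cong (⊛-congˡ (Q ⊛ Q ⊛ Q) (⊝-congˡ oneS q²≈q¹q¹))
                        (⊝-congˡ oneS (⊛-congˡ Q q²≈q¹q¹)))
                (≈-sym (≗⇒≈ distinctGF₀-0)) ⟩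
    Q ⊛ Q ⊛ Q ⊛ (oneS ⊝ q ^ 1 ⊛ q ^ 1) ⊛ (oneS ⊝ Q ⊛ (q ^ 1 ⊛ q ^ 1)) ⊛ distinctGF 0 0 ∎
    where
    Q = q ^ 2
    a = oneS ⊝ Q
    b = oneS ⊝ Q ⊛ Q
    q²≈q¹q¹ : Q ≈[ n ] q ^ 1 ⊛ q ^ 1
    q²≈q¹q¹ = ^-+ q 1 1
  distinctGF₂-closed (suc M) = begin
    a ⊛ b ⊛ distinctGF 2 (5 ℕ.+ M)
      ≈⟨ ⊛-congˡ (a ⊛ b) (distinctGF-suc-suc 1 (3 ℕ.+ M)) ⟩
    a ⊛ b ⊛ ((oneS ⊕ x) ⊛ D₂ ⊕ x ⊛ D₁)
      ≈⟨ solve 5 (λ a b x d₂ d₁ → a :* b :* ((𝟏 :+ x) :* d₂ :+ x :* d₁)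
                               := (𝟏 :+ x) :* (a :* b :* d₂) :+ x :* b :* (a :* d₁))
                 ≈-refl a b x D₂ D₁ ⟩
    (oneS ⊕ x) ⊛ (a ⊛ b ⊛ D₂) ⊕ x ⊛ b ⊛ (a ⊛ D₁)
      ≈⟨ ⊕-cong (⊛-cong (⊕-congˡ oneS x≈Q²y) (distinctGF₂-closed M))
                (⊛-cong (⊛-congʳ b x≈Q²y) D₁-closed) ⟩
    (oneS ⊕ Q ⊛ (Q ⊛ y)) ⊛ (Q ⊛ Q ⊛ Q ⊛ (oneS ⊝ y ⊛ y) ⊛ c ⊛ D₀)
      ⊕ Q ⊛ (Q ⊛ y) ⊛ b ⊛ (Q ⊛ c ⊛ ((oneS ⊕ y) ⊛ D₀))
      ≈⟨ solve 4 (λ Q y c d₀ → (𝟏 :+ Q :* (Q :* y)) :* (Q :* Q :* Q :* (𝟏 :- y :* y) :* c :* d₀)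
                                 :+ Q :* (Q :* y) :* (𝟏 :- Q :* Q) :* (Q :* c :* ((𝟏 :+ y) :* d₀))
                            := Q :* Q :* Q :* c :* (𝟏 :- Q :* (Q :* (y :* y))) :* ((𝟏 :+ y) :* d₀))
                 ≈-refl Q y c D₀ ⟩
    Q ⊛ Q ⊛ Q ⊛ c ⊛ (oneS ⊝ Q ⊛ (Q ⊛ (y ⊛ y))) ⊛ ((oneS ⊕ y) ⊛ D₀)
      ≈⟨ ⊛-cong (⊛-cong (⊛-congˡ (Q ⊛ Q ⊛ Q) c≈)
                        (⊝-congˡ oneS (⊛-congˡ Q (≈-sym (q^suc-squared M)))))
                (≈-sym (distinctGF₀-suc M)) ⟩
    Q ⊛ Q ⊛ Q ⊛ (oneS ⊝ y′ ⊛ y′) ⊛ (oneS ⊝ Q ⊛ (y′ ⊛ y′)) ⊛ distinctGF 0 (suc M) ∎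
    where
    Q = q ^ 2
    a = oneS ⊝ Q
    b = oneS ⊝ Q ⊛ Q
    y = q ^ suc M
    y′ = q ^ suc (suc M)
    c = oneS ⊝ Q ⊛ (y ⊛ y)
    x = q ^ (5 ℕ.+ M)
    D₀ = distinctGF 0 M
    D₁ = distinctGF 1 (3 ℕ.+ M)
    D₂ = distinctGF 2 (4 ℕ.+ M)
    c≈ : c ≈[ n ] oneS ⊝ y′ ⊛ y′
    c≈ = ⊝-congˡ oneS (≈-sym (q^suc-squared M))
    x≈Q²y : x ≈[ n ] Q ⊛ (Q ⊛ y)
    x≈Q²y = ≈-trans (^-+ q 2 (3 ℕ.+ M)) (⊛-congˡ Q (^-+ q 2 (suc M)))
    D₁-closed : a ⊛ D₁ ≈[ n ] Q ⊛ c ⊛ ((oneS ⊕ y) ⊛ D₀)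
    D₁-closed = ≈-trans (distinctGF₁-closed (suc M))
                        (⊛-cong (⊛-congˡ Q (≈-sym c≈)) (distinctGF₀-suc M))

distinctGF-stable : ∀ r {N N′} → N ≤ N′ → distinctGF r N′ ≈[ N ] distinctGF r N
distinctGF-stable r {N} = ≈-stable (distinctGF r) (λ k N≤k → ≈-weaken N≤k (step k))
  where
  step : ∀ k → distinctGF r (suc k) ≈[ k ] distinctGF r k
  step k = ≈-trans (distinctGF-suc r k)
                   (≈-trans (⊕-congʳ D (⊛-congʳ G (q^≈0 (ℕ.n<1+n k))))
                            (≗⇒≈ (λ m → trans (cong (_+ D m) (constS-⊛ (+ 0) G m)) (ℤ.+-identityˡ (D m)))))
    where
    G = weightedGF (λ λs → hooks2 (suc k ∷ λs) C r) (distinctUpTo k)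
    D = distinctGF r k

-- Euler's identity

q-pochhammer : ℕ → Series
q-pochhammer N = prodUpTo N (λ i → oneS ⊝ q ^ suc i)

q²-pochhammer : ℕ → Series
q²-pochhammer K = prodUpTo K (λ i → oneS ⊝ q ^ suc i ⊛ q ^ suc i)

odd-pochhammer : ℕ → Series
odd-pochhammer K = prodUpTo K (λ k → oneMinusQ (2 ℕ.* k ℕ.+ 1))

q²-pochhammer-coeff₀ : ∀ K → q²-pochhammer K 0 ≡ + 1
q²-pochhammer-coeff₀ K = prodUpTo-coeff₀ K (λ i → oneS ⊝ q ^ suc i ⊛ q ^ suc i) (λ _ → refl)

module _ {n : ℕ} where
  open SetoidReasoning (CommutativeRing.setoid (⊕-⊛-commutativeRing n))
  open ⊛-Solver n using (solve; _:=_; con; _:+_; _:-_; _:*_)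

  oddFactor≈ : ∀ k → oneMinusQ (2 ℕ.* k ℕ.+ 1) ≈[ n ] oneS ⊝ q ^ suc (k ℕ.+ k)
  oddFactor≈ k rewrite ℕ.+-comm (2 ℕ.* k) 1 | ℕ.+-identityʳ k = oneMinusQ≈1⊝q^ (k ℕ.+ k)

  oddFactor≈1 : ∀ k → n < suc (k ℕ.+ k) → oneMinusQ (2 ℕ.* k ℕ.+ 1) ≈[ n ] oneS
  oddFactor≈1 k n<2k+1 =
    ≈-trans (oddFactor≈ k) (≈-trans (⊝-congˡ oneS (q^≈0 n<2k+1)) (solve 0 (𝟏 :- con (+ 0) := 𝟏) ≈-refl))

  distinctGF₀⊛q-pochhammer : ∀ N → distinctGF 0 N ⊛ q-pochhammer N ≈[ n ] q²-pochhammer N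
  distinctGF₀⊛q-pochhammer zero =
    ≈-trans (⊛-congʳ oneS (≗⇒≈ distinctGF₀-0)) (≗⇒≈ (⊛-identityˡ oneS))
  distinctGF₀⊛q-pochhammer (suc N) = begin
    distinctGF 0 (suc N) ⊛ (E ⊛ (oneS ⊝ y))
      ≈⟨ ⊛-congʳ (E ⊛ (oneS ⊝ y)) (distinctGF₀-suc N) ⟩
    (oneS ⊕ y) ⊛ D ⊛ (E ⊛ (oneS ⊝ y))
      ≈⟨ solve 3 (λ y d e → (𝟏 :+ y) :* d :* (e :* (𝟏 :- y)) := d :* e :* (𝟏 :- y :* y)) ≈-refl y D E ⟩
    D ⊛ E ⊛ (oneS ⊝ y ⊛ y)
      ≈⟨ ⊛-congʳ (oneS ⊝ y ⊛ y) (distinctGF₀⊛q-pochhammer N) ⟩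
    q²-pochhammer N ⊛ (oneS ⊝ y ⊛ y) ∎
    where
    y = q ^ suc N
    D = distinctGF 0 N
    E = q-pochhammer N

  q-pochhammer-split : ∀ K → q-pochhammer (K ℕ.+ K) ≈[ n ] odd-pochhammer K ⊛ q²-pochhammer K
  q-pochhammer-split zero = ≗⇒≈ (λ m → sym (⊛-identityˡ oneS m))
  q-pochhammer-split (suc K) rewrite ℕ.+-suc K K = begin
    E ⊛ (oneS ⊝ z) ⊛ (oneS ⊝ q ⊛ z)
      ≈⟨ ⊛-congʳ (oneS ⊝ q ⊛ z) (⊛-congʳ (oneS ⊝ z) (q-pochhammer-split K)) ⟩
    O ⊛ G ⊛ (oneS ⊝ z) ⊛ (oneS ⊝ q ⊛ z)
      ≈⟨ solve 4 (λ o g z w → o :* g :* (𝟏 :- z) :* (𝟏 :- w) := o :* (𝟏 :- z) :* (g :* (𝟏 :- w)))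
                 ≈-refl O G z (q ⊛ z) ⟩
    O ⊛ (oneS ⊝ z) ⊛ (G ⊛ (oneS ⊝ q ⊛ z))
      ≈⟨ ⊛-cong (⊛-congˡ O (≈-sym (oddFactor≈ K))) (⊛-congˡ G (⊝-congˡ oneS (≈-sym square))) ⟩
    O ⊛ oneMinusQ (2 ℕ.* K ℕ.+ 1) ⊛ (G ⊛ (oneS ⊝ q ^ suc K ⊛ q ^ suc K)) ∎
    where
    E = q-pochhammer (K ℕ.+ K)
    O = odd-pochhammer K
    G = q²-pochhammer K
    z = q ^ suc (K ℕ.+ K)
    square : q ^ suc K ⊛ q ^ suc K ≈[ n ] q ⊛ z
    square = ≈-trans (≈-sym (^-+ q (suc K) (suc K)))
                     (≗⇒≈ (λ m → cong (λ k → (q ^ suc k) m) (ℕ.+-suc K K)))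

  distinctGF₀⊛odd-pochhammer≈1 : ∀ K → n ≤ K → distinctGF 0 (K ℕ.+ K) ⊛ odd-pochhammer K ≈[ n ] oneS
  distinctGF₀⊛odd-pochhammer≈1 K n≤K = ⊛-cancelˡ G (q²-pochhammer-coeff₀ K) (begin
    G ⊛ (D ⊛ O)                 ≈⟨ solve 3 (λ g d o → g :* (d :* o) := d :* (o :* g)) ≈-refl G D O ⟩
    D ⊛ (O ⊛ G)                 ≈⟨ ⊛-congˡ D (≈-sym (q-pochhammer-split K)) ⟩
    D ⊛ q-pochhammer (K ℕ.+ K)  ≈⟨ distinctGF₀⊛q-pochhammer (K ℕ.+ K) ⟩
    q²-pochhammer (K ℕ.+ K)     ≈⟨ prodUpTo-stable (λ i → oneS ⊝ q ^ suc i ⊛ q ^ suc i)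
                                                   factor≈1 (ℕ.m≤m+n K K) ⟩
    G                           ≈⟨ solve 1 (λ g → g := g :* 𝟏) ≈-refl G ⟩
    G ⊛ oneS                    ∎)
    where
    G = q²-pochhammer K
    D = distinctGF 0 (K ℕ.+ K)
    O = odd-pochhammer K
    factor≈1 : ∀ k → K ≤ k → oneS ⊝ q ^ suc k ⊛ q ^ suc k ≈[ n ] oneS
    factor≈1 k K≤k = ≈-trans (⊝-congˡ oneS (⊛-cong y≈0 y≈0))
                             (solve 0 (𝟏 :- con (+ 0) :* con (+ 0) := 𝟏) ≈-refl)
      where y≈0 = q^≈0 (s≤s (ℕ.≤-trans n≤K K≤k))

  distinctGF₂-truncated : ∀ {N} → n ≤ N →
                          (oneS ⊝ q ^ 2) ⊛ (oneS ⊝ q ^ 2 ⊛ q ^ 2) ⊛ distinctGF 2 (4 ℕ.+ n)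
                          ≈[ n ] q ^ 2 ⊛ q ^ 2 ⊛ q ^ 2 ⊛ distinctGF 0 N
  distinctGF₂-truncated {N} n≤N = begin
    (oneS ⊝ Q) ⊛ (oneS ⊝ Q ⊛ Q) ⊛ distinctGF 2 (4 ℕ.+ n)
      ≈⟨ distinctGF₂-closed n ⟩
    Q ⊛ Q ⊛ Q ⊛ (oneS ⊝ y ⊛ y) ⊛ (oneS ⊝ Q ⊛ (y ⊛ y)) ⊛ distinctGF 0 n
      ≈⟨ ⊛-cong (⊛-cong (⊛-congˡ (Q ⊛ Q ⊛ Q) (⊝-congˡ oneS y²≈0))
                        (⊝-congˡ oneS (⊛-congˡ Q y²≈0)))
                (≈-sym (distinctGF-stable 0 n≤N)) ⟩
    Q ⊛ Q ⊛ Q ⊛ (oneS ⊝ 0′ ⊛ 0′) ⊛ (oneS ⊝ Q ⊛ (0′ ⊛ 0′)) ⊛ distinctGF 0 N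
      ≈⟨ solve 2 (λ Q d → Q :* Q :* Q :* (𝟏 :- 0′′ :* 0′′) :* (𝟏 :- Q :* (0′′ :* 0′′)) :* d
                       := Q :* Q :* Q :* d)
                 ≈-refl Q (distinctGF 0 N) ⟩
    Q ⊛ Q ⊛ Q ⊛ distinctGF 0 N ∎
    where
    Q = q ^ 2
    y = q ^ suc n
    0′ = constS (+ 0)
    0′′ = con (+ 0)
    y²≈0 : y ⊛ y ≈[ n ] 0′ ⊛ 0′
    y²≈0 = ⊛-cong (q^≈0 (ℕ.n<1+n n)) (q^≈0 (ℕ.n<1+n n))

lhsSeries≈distinctGF₂ : ∀ {n N} → n ≤ N → lhsSeries ≈[ n ] distinctGF 2 N
lhsSeries≈distinctGF₂ n≤N = mk≈ (λ m m≤n →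
  trans (lhsSeries≡distinctGF₂ m) (sym (coeff-≡ (distinctGF-stable 2 (ℕ.≤-trans m≤n n≤N)) m ℕ.≤-refl)))

qq2∞≈odd-pochhammer : ∀ {n K} → n < K → qq2∞ ≈[ n ] odd-pochhammer K
qq2∞≈odd-pochhammer n<K = mk≈ (λ m m≤n →
  sym (coeff-≡ (prodUpTo-stable (λ k → oneMinusQ (2 ℕ.* k ℕ.+ 1)) factor≈1 (ℕ.≤-trans (s≤s m≤n) n<K))
               m ℕ.≤-refl))
  where
  factor≈1 : ∀ {m} k → suc m ≤ k → oneMinusQ (2 ℕ.* k ℕ.+ 1) ≈[ m ] oneS
  factor≈1 k m<k = oddFactor≈1 k (ℕ.≤-trans m<k (ℕ.≤-trans (ℕ.m≤m+n k k) (ℕ.n≤1+n (k ℕ.+ k))))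

corollary2p8 : ∀ n → (lhsSeries ⊛ (qq2∞ ⊛ oneMinusQ 2 ⊛ oneMinusQ 4)) n ≡ qPow 6 n
corollary2p8 n = coeff-≡ identity n ℕ.≤-refl
  where
  open SetoidReasoning (CommutativeRing.setoid (⊕-⊛-commutativeRing n))
  open ⊛-Solver n using (solve; _:=_; _:*_)
  K = suc n
  Q = q ^ 2
  a = oneS ⊝ Q
  b = oneS ⊝ Q ⊛ Q
  O = odd-pochhammer K
  D₀ = distinctGF 0 (K ℕ.+ K)
  D₂ = distinctGF 2 (4 ℕ.+ n)
  identity : lhsSeries ⊛ (qq2∞ ⊛ oneMinusQ 2 ⊛ oneMinusQ 4) ≈[ n ] qPow 6
  identity = begin
    lhsSeries ⊛ (qq2∞ ⊛ oneMinusQ 2 ⊛ oneMinusQ 4)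
      ≈⟨ ⊛-cong (lhsSeries≈distinctGF₂ (ℕ.m≤n+m n 4))
                (⊛-cong (⊛-cong (qq2∞≈odd-pochhammer (ℕ.n<1+n n)) (oneMinusQ≈1⊝q^ 1))
                        (≈-trans (oneMinusQ≈1⊝q^ 3) (⊝-congˡ oneS (^-+ q 2 2)))) ⟩
    D₂ ⊛ (O ⊛ a ⊛ b)
      ≈⟨ solve 4 (λ d o a b → d :* (o :* a :* b) := a :* b :* d :* o) ≈-refl D₂ O a b ⟩
    a ⊛ b ⊛ D₂ ⊛ O
      ≈⟨ ⊛-congʳ O (distinctGF₂-truncated (ℕ.≤-trans (ℕ.n≤1+n n) (ℕ.m≤m+n K K))) ⟩
    Q ⊛ Q ⊛ Q ⊛ D₀ ⊛ O
      ≈⟨ solve 3 (λ Q d o → Q :* Q :* Q :* d :* o := Q :* Q :* Q :* (d :* o)) ≈-refl Q D₀ O ⟩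
    Q ⊛ Q ⊛ Q ⊛ (D₀ ⊛ O)
      ≈⟨ ⊛-congˡ (Q ⊛ Q ⊛ Q) (distinctGF₀⊛odd-pochhammer≈1 K (ℕ.n≤1+n n)) ⟩
    Q ⊛ Q ⊛ Q ⊛ oneS
      ≈⟨ solve 1 (λ Q → Q :* Q :* Q :* 𝟏 := Q :* Q :* Q) ≈-refl Q ⟩
    Q ⊛ Q ⊛ Q
      ≈⟨ ≈-sym qPow6≈q²q²q² ⟩
    qPow 6 ∎
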